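{- Let $m \geq 2$, $B \in SL_{2}(\mathbb{Z}/2^{m}\mathbb{Z})$ and $n>4$. Let $\Delta_{k}^{B}(m):=\{(a_{1},\ldots,a_{k}) \in (\mathbb{Z}/2^{m}\mathbb{Z})^{k}:~M_{k}(a_{1},\ldots,a_{k})=B \text{ and } a_{2} \text{ is invertible in } \mathbb{Z}/2^m\mathbb{Z}\}$. Then \[\left|\Delta_{n}^{B}(m)\right|=\frac{2^{mn-n-4m+1}(2^{n}+(-1)^{n}\times 8)}{3}\left|\Delta_{4}^{B}(m)\right|+\frac{2^{mn-n-3m}(2^{n}+(-1)^{n+1}\times 16)}{3}\left|\Delta_{3}^{B}(m)\right|.\]
   Context: For $a_1,\ldots,a_k$ in a commutative unitary ring, $M_{k}(a_1,\ldots,a_k):=\begin{pmatrix} a_{k} & -1 \\ 1 & 0\end{pmatrix}\begin{pmatrix} a_{k-1} & -1 \\ 1 & 0\end{pmatrix}\cdots\begin{pmatrix} a_{1} & -1 \\ 1 & 0\end{pmatrix}$. -}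

module Defs where

open import Data.Nat as ℕ using (ℕ; zero; suc; NonZero)
open import Data.Nat.Properties using (m^n≢0)
open import Data.Nat.DivMod using (_mod_)
open import Data.Fin as Fin using (Fin; toℕ)
open import Data.Fin.Properties as FinP using (any?)
open import Data.Product using (Σ; _×_; _,_)
open import Data.Product.Properties using (≡-dec)
open import Data.Vec using (Vec; []; _∷_)
open import Data.List using (List; []; _∷_; map; concatMap; length; filter)
open import Data.Empty using (⊥)
open import Relation.Nullary using (Dec; yes; no; _×-dec_)
open import Relation.Binary.PropositionalEquality using (_≡_)
open import Data.Integer as ℤ using (ℤ; +_; -[1+_])
open import Data.Rational as ℚ using (ℚ; _/_)

Zmod : ℕ → Set
Zmod m = Fin (2 ℕ.^ m)

module _ (m : ℕ) where
  private
    N : ℕ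
    N = 2 ℕ.^ m
    instance
      N≢0 : NonZero N
      N≢0 = m^n≢0 2 m

  infixl 6 _+ₘ_ _-ₘ_
  infixl 7 _*ₘ_

  _+ₘ_ : Zmod m → Zmod m → Zmod m
  a +ₘ b = (toℕ a ℕ.+ toℕ b) mod N

  _*ₘ_ : Zmod m → Zmod m → Zmod m
  a *ₘ b = (toℕ a ℕ.* toℕ b) mod N

  -ₘ_ : Zmod m → Zmod m
  -ₘ a = (N ℕ.∸ toℕ a) mod N

  _-ₘ_ : Zmod m → Zmod m → Zmod m
  a -ₘ b = a +ₘ (-ₘ b)

  0ₘ 1ₘ : Zmod m
  0ₘ = 0 mod N
  1ₘ = 1 mod N

  -- 2x2 matrices ((a , b) , (c , d)) = [[a, b], [c, d]]
  Mat : Set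
  Mat = (Zmod m × Zmod m) × (Zmod m × Zmod m)

  _⊗_ : Mat → Mat → Mat
  ((a , b) , (c , d)) ⊗ ((e , f) , (g , h)) =
    ((a *ₘ e +ₘ b *ₘ g , a *ₘ f +ₘ b *ₘ h) ,
     (c *ₘ e +ₘ d *ₘ g , c *ₘ f +ₘ d *ₘ h))

  I₂ : Mat
  I₂ = ((1ₘ , 0ₘ) , (0ₘ , 1ₘ))

  elem : Zmod m → Mat
  elem a = ((a , -ₘ 1ₘ) , (1ₘ , 0ₘ))

  det : Mat → Zmod m
  det ((a , b) , (c , d)) = a *ₘ d -ₘ b *ₘ c

  InSL₂ : Mat → Set
  InSL₂ B = det B ≡ 1ₘ

  -- M_k(a₁,…,a_k) = elem(a_k) ⊗ … ⊗ elem(a₁); the vector is (a₁ ∷ … ∷ a_k ∷ [])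
  Mk-acc : ∀ {k} → Mat → Vec (Zmod m) k → Mat
  Mk-acc acc [] = acc
  Mk-acc acc (a ∷ as) = Mk-acc (elem a ⊗ acc) as

  Mk : ∀ {k} → Vec (Zmod m) k → Mat
  Mk v = Mk-acc I₂ v

  IsUnit : Zmod m → Set
  IsUnit a = Σ (Zmod m) λ b → a *ₘ b ≡ 1ₘ

  isUnit? : (a : Zmod m) → Dec (IsUnit a)
  isUnit? a = any? (λ b → a *ₘ b Fin.≟ 1ₘ)

  SecondUnit : ∀ {k} → Vec (Zmod m) k → Set
  SecondUnit (_ ∷ a ∷ _) = IsUnit a
  SecondUnit _ = ⊥

  secondUnit? : ∀ {k} (v : Vec (Zmod m) k) → Dec (SecondUnit v)
  secondUnit? [] = no λ ()
  secondUnit? (_ ∷ []) = no λ ()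
  secondUnit? (_ ∷ a ∷ _) = isUnit? a

  _≟M_ : (A B : Mat) → Dec (A ≡ B)
  _≟M_ = ≡-dec (≡-dec Fin._≟_ Fin._≟_) (≡-dec Fin._≟_ Fin._≟_)

  InΔ : ∀ {k} → Mat → Vec (Zmod m) k → Set
  InΔ B v = (Mk v ≡ B) × SecondUnit v

  inΔ? : ∀ {k} (B : Mat) (v : Vec (Zmod m) k) → Dec (InΔ B v)
  inΔ? B v = (Mk v ≟M B) ×-dec secondUnit? v

  allVecs : (k : ℕ) → List (Vec (Zmod m) k)
  allVecs zero = [] ∷ []
  allVecs (suc k) = concatMap (λ a → map (a ∷_) (allVecs k)) (Data.List.allFin N)
    where import Data.List

  cardΔ : (k : ℕ) → Mat → ℕ
  cardΔ k B = length (filter (inΔ? B) (allVecs k))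

pow2 : ℤ → ℚ
pow2 (+ n) = (+ (2 ℕ.^ n)) / 1
pow2 -[1+ n ] = _/_ (+ 1) (2 ℕ.^ suc n) {{m^n≢0 2 (suc n)}}

sgn : ℕ → ℤ
sgn zero = + 1
sgn (suc n) = ℤ.- sgn n

-- Since M_{k+1}(w, a) = elem(a) M_k(w), the tuples of length k + 1 with product B and last
-- entry a are exactly the tuples of length k with product elem(a)⁻¹ B; for k ≥ 2 this gives
-- |Δ_{k+1}^B| = Σ_a |Δ_k^{elem(a)⁻¹ B}|.  Left multiplication by elem(a)⁻¹ preserves the
-- determinant and turns the (2,2)-entry s of B = [[p, q], [r, s]] into a s − q.  For det B = 1
-- the equations M_3(a₁, a₂, a₃) = B force a₂ = −s, a₃ s = q − 1 and a₁ = a₃ r − p, so |Δ_3^B|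
-- is 1 if s is a unit, i.e. odd, and 0 otherwise.  If s is odd then a s − q takes each parity
-- 2^{m−1} times as a ranges over ℤ/2^m; if s is even then q is odd and so is every a s − q.
-- Hence Z_i = |Δ_{3+i}^B| depends only on the parity of s, and in both cases it satisfies
-- Z_{i+2} = c Z_{i+1} + 2c² Z_i with c = 2^{m−1}.  The characteristic roots 2c and −c give the
-- stated closed form in terms of Z_0 = |Δ_3^B| and Z_1 = |Δ_4^B|.

module Submission where

open import Defs
open import Algebra.Bundles using (CommutativeRing)
import Algebra.Consequences.Propositional as Consequences
import Algebra.Properties.CommutativeSemigroup as CommutativeSemigroupProperties
import Algebra.Properties.Ring as RingProperties
open import Algebra.Solver.Ring.AlmostCommutativeRing
  using (AlmostCommutativeRing; fromCommutativeRing; _-Raw-AlmostCommutative⟶_)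
open import Data.Bool using (true; false)
open import Data.Empty using (⊥-elim)
open import Data.Fin as Fin using (Fin; toℕ)
import Data.Fin.Properties as Fin
open import Data.Integer as ℤ using (ℤ; -[1+_]; 0ℤ; 1ℤ)
import Data.Integer.Properties as ℤ
open import Data.List as List using (List; []; _∷_; length; filter; concatMap; tabulate; _++_)
import Data.List.Properties as List
open import Data.Maybe using (Maybe; map)
open import Data.Nat as ℕ using (ℕ; zero; suc; NonZero)
open import Data.Nat.DivMod
  using (_mod_; %-distribˡ-+; %-distribˡ-*; m<n⇒m%n≡m; [m+n]%n≡m%n; m∣n⇒o%n%m≡o%m; m≡m%n+[m/n]*n)
open import Data.Nat.Divisibility using (m∣m*n)
import Data.Nat.Properties as ℕ
open import Data.Nat.Tactic.RingSolver using () renaming (solve-∀ to ℕ-solve-∀)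
open import Algebra.Properties.Semiring.Sum ℕ.+-*-semiring
  using (sum-syntax; ∑-comm; sum-cong-≗; sum-replicate-zero)
open import Data.Product using (_×_; _,_; proj₁; proj₂; map₁; uncurry)
open import Data.Vec using (Vec; []; _∷_; _∷ʳ_)
open import Data.Vec.Properties using (∷-injectiveˡ; ∷-injectiveʳ)
open import Function using (_∘_; _⇔_; mk⇔; Equivalence)
open import Function.Construct.Composition using (_⇔-∘_)
open import Level using (0ℓ)
open import Relation.Nullary using (Dec; yes; no; ¬_; does)
open import Relation.Nullary.Decidable using (dec⇒maybe)
open import Relation.Unary using (Pred; Decidable)
open import Relation.Binary.PropositionalEquality
  using (_≡_; refl; sym; trans; cong; cong₂; subst; isEquivalence; module ≡-Reasoning)

module ZmodRing (m : ℕ) where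

  private
    N : ℕ
    N = 2 ℕ.^ m

  instance
    2^m≢0 : NonZero (2 ℕ.^ m)
    2^m≢0 = ℕ.m^n≢0 2 m

  infixl 6 _+_ _-_
  infixl 7 _*_

  _+_ _*_ _-_ : Zmod m → Zmod m → Zmod m
  _+_ = _+ₘ_ m
  _*_ = _*ₘ_ m
  _-_ = _-ₘ_ m

  -_ : Zmod m → Zmod m
  -_ = -ₘ_ m

  [_] : ℕ → Zmod m
  [ x ] = x mod N

  toℕ-[] : ∀ x → toℕ [ x ] ≡ x ℕ.% N
  toℕ-[] x = Fin.toℕ-fromℕ< _

  []-toℕ : ∀ a → [ toℕ a ] ≡ a
  []-toℕ a = Fin.toℕ-injective (trans (toℕ-[] (toℕ a)) (m<n⇒m%n≡m (Fin.toℕ<n a)))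

  []-+ : ∀ x y → [ x ℕ.+ y ] ≡ [ x ] + [ y ]
  []-+ x y = Fin.toℕ-injective (begin
    toℕ [ x ℕ.+ y ]                           ≡⟨ toℕ-[] _ ⟩
    (x ℕ.+ y) ℕ.% N                           ≡⟨ %-distribˡ-+ x y N ⟩
    (x ℕ.% N ℕ.+ y ℕ.% N) ℕ.% N               ≡⟨ cong₂ (λ u v → (u ℕ.+ v) ℕ.% N) (toℕ-[] x) (toℕ-[] y) ⟨
    (toℕ [ x ] ℕ.+ toℕ [ y ]) ℕ.% N           ≡⟨ toℕ-[] _ ⟨
    toℕ ([ x ] + [ y ])                       ∎)
    where open ≡-Reasoning

  []-* : ∀ x y → [ x ℕ.* y ] ≡ [ x ] * [ y ]
  []-* x y = Fin.toℕ-injective (begin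
    toℕ [ x ℕ.* y ]                           ≡⟨ toℕ-[] _ ⟩
    (x ℕ.* y) ℕ.% N                           ≡⟨ %-distribˡ-* x y N ⟩
    (x ℕ.% N ℕ.* (y ℕ.% N)) ℕ.% N             ≡⟨ cong₂ (λ u v → (u ℕ.* v) ℕ.% N) (toℕ-[] x) (toℕ-[] y) ⟨
    (toℕ [ x ] ℕ.* toℕ [ y ]) ℕ.% N           ≡⟨ toℕ-[] _ ⟨
    toℕ ([ x ] * [ y ])                       ∎)
    where open ≡-Reasoning

  []-+ˡ : ∀ x a → [ x ] + a ≡ [ x ℕ.+ toℕ a ]
  []-+ˡ x a = trans (cong (_+_ [ x ]) (sym ([]-toℕ a))) (sym ([]-+ x (toℕ a)))

  []-+ʳ : ∀ a x → a + [ x ] ≡ [ toℕ a ℕ.+ x ]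
  []-+ʳ a x = trans (cong (_+ [ x ]) (sym ([]-toℕ a))) (sym ([]-+ (toℕ a) x))

  []-*ˡ : ∀ x a → [ x ] * a ≡ [ x ℕ.* toℕ a ]
  []-*ˡ x a = trans (cong (_*_ [ x ]) (sym ([]-toℕ a))) (sym ([]-* x (toℕ a)))

  []-*ʳ : ∀ a x → a * [ x ] ≡ [ toℕ a ℕ.* x ]
  []-*ʳ a x = trans (cong (_* [ x ]) (sym ([]-toℕ a))) (sym ([]-* (toℕ a) x))

  +-comm : ∀ a b → a + b ≡ b + a
  +-comm a b = cong [_] (ℕ.+-comm (toℕ a) (toℕ b))

  *-comm : ∀ a b → a * b ≡ b * a
  *-comm a b = cong [_] (ℕ.*-comm (toℕ a) (toℕ b))

  +-assoc : ∀ a b c → (a + b) + c ≡ a + (b + c)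
  +-assoc a b c = begin
    [ toℕ a ℕ.+ toℕ b ] + c            ≡⟨ []-+ˡ _ c ⟩
    [ toℕ a ℕ.+ toℕ b ℕ.+ toℕ c ]      ≡⟨ cong [_] (ℕ.+-assoc (toℕ a) (toℕ b) (toℕ c)) ⟩
    [ toℕ a ℕ.+ (toℕ b ℕ.+ toℕ c) ]    ≡⟨ []-+ʳ a _ ⟨
    a + [ toℕ b ℕ.+ toℕ c ]            ∎
    where open ≡-Reasoning

  *-assoc : ∀ a b c → (a * b) * c ≡ a * (b * c)
  *-assoc a b c = begin
    [ toℕ a ℕ.* toℕ b ] * c            ≡⟨ []-*ˡ _ c ⟩
    [ toℕ a ℕ.* toℕ b ℕ.* toℕ c ]      ≡⟨ cong [_] (ℕ.*-assoc (toℕ a) (toℕ b) (toℕ c)) ⟩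
    [ toℕ a ℕ.* (toℕ b ℕ.* toℕ c) ]    ≡⟨ []-*ʳ a _ ⟨
    a * [ toℕ b ℕ.* toℕ c ]            ∎
    where open ≡-Reasoning

  *-distribˡ-+ : ∀ a b c → a * (b + c) ≡ a * b + a * c
  *-distribˡ-+ a b c = begin
    a * [ toℕ b ℕ.+ toℕ c ]                     ≡⟨ []-*ʳ a _ ⟩
    [ toℕ a ℕ.* (toℕ b ℕ.+ toℕ c) ]             ≡⟨ cong [_] (ℕ.*-distribˡ-+ (toℕ a) (toℕ b) (toℕ c)) ⟩
    [ toℕ a ℕ.* toℕ b ℕ.+ toℕ a ℕ.* toℕ c ]     ≡⟨ []-+ _ _ ⟩
    a * b + a * c                               ∎
    where open ≡-Reasoning

  +-identityˡ : ∀ a → 0ₘ m + a ≡ a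
  +-identityˡ a = trans ([]-+ˡ 0 a) ([]-toℕ a)

  *-identityˡ : ∀ a → 1ₘ m * a ≡ a
  *-identityˡ a = trans ([]-*ˡ 1 a) (trans (cong [_] (ℕ.*-identityˡ (toℕ a))) ([]-toℕ a))

  [2^m]≡0 : [ 2 ℕ.^ m ] ≡ 0ₘ m
  [2^m]≡0 = Fin.fromℕ<-cong _ _ ([m+n]%n≡m%n 0 N) _ _

  -‿inverseˡ : ∀ a → - a + a ≡ 0ₘ m
  -‿inverseˡ a = begin
    [ N ℕ.∸ toℕ a ] + a         ≡⟨ []-+ˡ _ a ⟩
    [ N ℕ.∸ toℕ a ℕ.+ toℕ a ]   ≡⟨ cong [_] (ℕ.m∸n+n≡m (ℕ.<⇒≤ (Fin.toℕ<n a))) ⟩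
    [ N ]                       ≡⟨ [2^m]≡0 ⟩
    0ₘ m                        ∎
    where open ≡-Reasoning

  commutativeRing : CommutativeRing 0ℓ 0ℓ
  commutativeRing = record
    { Carrier = Zmod m
    ; _≈_ = _≡_
    ; _+_ = _+_
    ; _*_ = _*_
    ; -_ = -ₘ_ m
    ; 0# = 0ₘ m
    ; 1# = 1ₘ m
    ; isCommutativeRing = record
      { isRing = record
        { +-isAbelianGroup = record
          { isGroup = record
            { isMonoid = record
              { isSemigroup = record
                { isMagma = record { isEquivalence = isEquivalence ; ∙-cong = cong₂ _+_ }
                ; assoc = +-assoc
                }
              ; identity = +-identityˡ , comm∧idˡ⇒idʳ +-comm +-identityˡ
              }
            ; inverse = -‿inverseˡ , comm∧invˡ⇒invʳ +-comm -‿inverseˡ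
            ; ⁻¹-cong = cong (-ₘ_ m)
            }
          ; comm = +-comm
          }
        ; *-cong = cong₂ _*_
        ; *-assoc = *-assoc
        ; *-identity = *-identityˡ , comm∧idˡ⇒idʳ *-comm *-identityˡ
        ; distrib = *-distribˡ-+ , comm∧distrˡ⇒distrʳ *-comm *-distribˡ-+
        }
      ; *-comm = *-comm
      }
    }
    where open Consequences

  private
    module R = CommutativeRing commutativeRing
  open RingProperties R.ring using (-0#≈0#; -‿involutive; -‿distribˡ-*; -‿distribʳ-*; -‿+-comm)
  open CommutativeSemigroupProperties R.+-commutativeSemigroup using (interchange)

  x-0≡x : ∀ a → a - 0ₘ m ≡ a
  x-0≡x a = trans (cong (_+_ a) -0#≈0#) (R.+-identityʳ a)

  [x+a]-[x+b]≡a-b : ∀ x a b → (x + a) - (x + b) ≡ a - b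
  [x+a]-[x+b]≡a-b x a b = begin
    (x + a) + - (x + b)       ≡⟨ cong (_+_ (x + a)) (-‿+-comm x b) ⟨
    (x + a) + (- x + - b)     ≡⟨ interchange x a (- x) (- b) ⟩
    (x - x) + (a - b)         ≡⟨ cong (_+ (a - b)) (R.-‿inverseʳ x) ⟩
    0ₘ m + (a - b)            ≡⟨ +-identityˡ (a - b) ⟩
    a - b                     ∎
    where open ≡-Reasoning

  fromℤ : ℤ → Zmod m
  fromℤ (ℤ.+ n)  = [ n ]
  fromℤ -[1+ n ] = - [ suc n ]

  fromℤ-neg-pos : ∀ n → fromℤ (ℤ.- ℤ.+ n) ≡ - [ n ]
  fromℤ-neg-pos zero    = sym -0#≈0#
  fromℤ-neg-pos (suc n) = refl

  fromℤ-neg : ∀ x → fromℤ (ℤ.- x) ≡ - fromℤ x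
  fromℤ-neg (ℤ.+ n)  = fromℤ-neg-pos n
  fromℤ-neg -[1+ n ] = sym (-‿involutive [ suc n ])

  fromℤ-⊖ : ∀ x y → fromℤ (x ℤ.⊖ y) ≡ [ x ] - [ y ]
  fromℤ-⊖ zero    zero    = sym (x-0≡x [ 0 ])
  fromℤ-⊖ zero    (suc y) = sym (+-identityˡ (- [ suc y ]))
  fromℤ-⊖ (suc x) zero    = sym (x-0≡x [ suc x ])
  fromℤ-⊖ (suc x) (suc y) = begin
    fromℤ (suc x ℤ.⊖ suc y)         ≡⟨ cong fromℤ (ℤ.[1+m]⊖[1+n]≡m⊖n x y) ⟩
    fromℤ (x ℤ.⊖ y)                 ≡⟨ fromℤ-⊖ x y ⟩
    [ x ] - [ y ]                   ≡⟨ [x+a]-[x+b]≡a-b [ 1 ] [ x ] [ y ] ⟨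
    ([ 1 ] + [ x ]) - ([ 1 ] + [ y ]) ≡⟨ cong₂ _-_ ([]-+ 1 x) ([]-+ 1 y) ⟨
    [ suc x ] - [ suc y ]           ∎
    where open ≡-Reasoning

  fromℤ-+ : ∀ x y → fromℤ (x ℤ.+ y) ≡ fromℤ x + fromℤ y
  fromℤ-+ (ℤ.+ a)  (ℤ.+ b)  = []-+ a b
  fromℤ-+ (ℤ.+ a)  -[1+ b ] = fromℤ-⊖ a (suc b)
  fromℤ-+ -[1+ a ] (ℤ.+ b)  = trans (fromℤ-⊖ b (suc a)) (+-comm [ b ] _)
  fromℤ-+ -[1+ a ] -[1+ b ] = begin
    - [ suc (suc (a ℕ.+ b)) ]       ≡⟨ cong (λ n → - [ suc n ]) (ℕ.+-suc a b) ⟨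
    - [ suc a ℕ.+ suc b ]           ≡⟨ cong -_ ([]-+ (suc a) (suc b)) ⟩
    - ([ suc a ] + [ suc b ])       ≡⟨ -‿+-comm [ suc a ] [ suc b ] ⟨
    - [ suc a ] + - [ suc b ]       ∎
    where open ≡-Reasoning

  fromℤ-*-pos : ∀ x b → fromℤ (x ℤ.* ℤ.+ b) ≡ fromℤ x * [ b ]
  fromℤ-*-pos (ℤ.+ a)  b = trans (cong fromℤ (sym (ℤ.pos-* a b))) ([]-* a b)
  fromℤ-*-pos -[1+ a ] b = begin
    fromℤ (ℤ.- ℤ.+ suc a ℤ.* ℤ.+ b)      ≡⟨ cong fromℤ (ℤ.neg-distribˡ-* (ℤ.+ suc a) (ℤ.+ b)) ⟨
    fromℤ (ℤ.- (ℤ.+ suc a ℤ.* ℤ.+ b))    ≡⟨ fromℤ-neg (ℤ.+ suc a ℤ.* ℤ.+ b) ⟩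
    - fromℤ (ℤ.+ suc a ℤ.* ℤ.+ b)        ≡⟨ cong -_ (fromℤ-*-pos (ℤ.+ suc a) b) ⟩
    - ([ suc a ] * [ b ])                ≡⟨ -‿distribˡ-* [ suc a ] [ b ] ⟩
    - [ suc a ] * [ b ]                  ∎
    where open ≡-Reasoning

  fromℤ-* : ∀ x y → fromℤ (x ℤ.* y) ≡ fromℤ x * fromℤ y
  fromℤ-* x (ℤ.+ b)  = fromℤ-*-pos x b
  fromℤ-* x -[1+ b ] = begin
    fromℤ (x ℤ.* ℤ.- ℤ.+ suc b)          ≡⟨ cong fromℤ (ℤ.neg-distribʳ-* x (ℤ.+ suc b)) ⟨
    fromℤ (ℤ.- (x ℤ.* ℤ.+ suc b))        ≡⟨ fromℤ-neg (x ℤ.* ℤ.+ suc b) ⟩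
    - fromℤ (x ℤ.* ℤ.+ suc b)            ≡⟨ cong -_ (fromℤ-*-pos x (suc b)) ⟩
    - (fromℤ x * [ suc b ])              ≡⟨ -‿distribʳ-* (fromℤ x) [ suc b ] ⟩
    fromℤ x * - [ suc b ]                ∎
    where open ≡-Reasoning

  almostCommutativeRing : AlmostCommutativeRing 0ℓ 0ℓ
  almostCommutativeRing = fromCommutativeRing commutativeRing

  fromℤ-homomorphism : ℤ.+-*-rawRing -Raw-AlmostCommutative⟶ almostCommutativeRing
  fromℤ-homomorphism = record
    { ⟦_⟧    = fromℤ
    ; +-homo = fromℤ-+
    ; *-homo = fromℤ-*
    ; -‿homo = fromℤ-neg
    ; 0-homo = refl
    ; 1-homo = refl
    }

  fromℤ-≟ : ∀ x y → Maybe (fromℤ x ≡ fromℤ y)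
  fromℤ-≟ x y = map (cong fromℤ) (dec⇒maybe (x ℤ.≟ y))

  -- Coefficients are integers mapped in by fromℤ, so that constants such as -1 normalise by
  -- evaluation even though the modulus 2^m is not a numeral.
  open import Algebra.Solver.Ring ℤ.+-*-rawRing almostCommutativeRing fromℤ-homomorphism fromℤ-≟ public
    using (solve; _:+_; _:*_; _:-_; :-_; con; _:=_)

  open import Algebra.Properties.CommutativeSemiring.Exp R.commutativeSemiring public using (_^_; ^-distrib-*)

  []-^ : ∀ x n → [ x ] ^ n ≡ [ x ℕ.^ n ]
  []-^ x zero    = refl
  []-^ x (suc n) = trans (cong (_*_ [ x ]) ([]-^ x n)) (sym ([]-* x (x ℕ.^ n)))

  geometricSum : Zmod m → ℕ → Zmod m
  geometricSum x zero    = 0ₘ m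
  geometricSum x (suc n) = 1ₘ m + x * geometricSum x n

  [1-x]*geometricSum+x^n≡1 : ∀ x n → (1ₘ m - x) * geometricSum x n + x ^ n ≡ 1ₘ m
  [1-x]*geometricSum+x^n≡1 x zero    = solve 1 (λ x → (con 1ℤ :- x) :* con 0ℤ :+ con 1ℤ := con 1ℤ) refl x
  [1-x]*geometricSum+x^n≡1 x (suc n) = begin
    (1ₘ m - x) * (1ₘ m + x * g) + x * x ^ n
      ≡⟨ solve 3 (λ x g y → (con 1ℤ :- x) :* (con 1ℤ :+ x :* g) :+ x :* y
                            := (con 1ℤ :- x) :+ x :* ((con 1ℤ :- x) :* g :+ y)) refl x g (x ^ n) ⟩
    (1ₘ m - x) + x * ((1ₘ m - x) * g + x ^ n)
      ≡⟨ cong (λ z → (1ₘ m - x) + x * z) ([1-x]*geometricSum+x^n≡1 x n) ⟩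
    (1ₘ m - x) + x * 1ₘ m
      ≡⟨ solve 1 (λ x → (con 1ℤ :- x) :+ x :* con 1ℤ := con 1ℤ) refl x ⟩
    1ₘ m ∎
    where
    open ≡-Reasoning
    g = geometricSum x n

  nilpotent⇒1-x-isUnit : ∀ x n → x ^ n ≡ 0ₘ m → IsUnit m (1ₘ m - x)
  nilpotent⇒1-x-isUnit x n x^n≡0 = geometricSum x n , (begin
    (1ₘ m - x) * geometricSum x n               ≡⟨ R.+-identityʳ _ ⟨
    (1ₘ m - x) * geometricSum x n + 0ₘ m        ≡⟨ cong (_+_ ((1ₘ m - x) * geometricSum x n)) x^n≡0 ⟨
    (1ₘ m - x) * geometricSum x n + x ^ n       ≡⟨ [1-x]*geometricSum+x^n≡1 x n ⟩
    1ₘ m                                        ∎)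
    where open ≡-Reasoning

module Matrix (m : ℕ) where

  open ZmodRing m

  infixr 7 _·_
  _·_ : Mat m → Mat m → Mat m
  _·_ = _⊗_ m

  elem⁻¹· : Zmod m → Mat m → Mat m
  elem⁻¹· a ((b₁₁ , b₁₂) , (b₂₁ , b₂₂)) = ((b₂₁ , b₂₂) , (a * b₂₁ - b₁₁ , a * b₂₂ - b₁₂))

  elem-·-elem⁻¹· : ∀ a B → elem m a · elem⁻¹· a B ≡ B
  elem-·-elem⁻¹· a ((b₁₁ , b₁₂) , (b₂₁ , b₂₂)) =
    cong₂ _,_ (cong₂ _,_ (row₁ a b₂₁ b₁₁) (row₁ a b₂₂ b₁₂))
              (cong₂ _,_ (row₂ a b₂₁ b₁₁) (row₂ a b₂₂ b₁₂))
    where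
    row₁ : ∀ a x y → a * x + - 1ₘ m * (a * x - y) ≡ y
    row₁ = solve 3 (λ a x y → a :* x :+ :- con 1ℤ :* (a :* x :- y) := y) refl
    row₂ : ∀ a x y → 1ₘ m * x + 0ₘ m * (a * x - y) ≡ x
    row₂ = solve 3 (λ a x y → con 1ℤ :* x :+ con 0ℤ :* (a :* x :- y) := x) refl

  elem⁻¹·-elem-· : ∀ a X → elem⁻¹· a (elem m a · X) ≡ X
  elem⁻¹·-elem-· a ((x₁₁ , x₁₂) , (x₂₁ , x₂₂)) =
    cong₂ _,_ (cong₂ _,_ (row₁ a x₁₁ x₂₁) (row₁ a x₁₂ x₂₂))
              (cong₂ _,_ (row₂ a x₁₁ x₂₁) (row₂ a x₁₂ x₂₂))
    where
    row₁ : ∀ a x y → 1ₘ m * x + 0ₘ m * y ≡ x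
    row₁ = solve 3 (λ a x y → con 1ℤ :* x :+ con 0ℤ :* y := x) refl
    row₂ : ∀ a x y → a * (1ₘ m * x + 0ₘ m * y) - (a * x + - 1ₘ m * y) ≡ y
    row₂ = solve 3 (λ a x y → a :* (con 1ℤ :* x :+ con 0ℤ :* y) :- (a :* x :+ :- con 1ℤ :* y) := y) refl

  elem-·≡⇔ : ∀ a X B → elem m a · X ≡ B ⇔ X ≡ elem⁻¹· a B
  elem-·≡⇔ a X B = mk⇔
    (λ { refl → sym (elem⁻¹·-elem-· a X) })
    (λ { refl → elem-·-elem⁻¹· a B })

  det-elem⁻¹· : ∀ a B → det m (elem⁻¹· a B) ≡ det m B
  det-elem⁻¹· a ((p , q) , (r , s)) = lemma a p q r s
    where
    lemma : ∀ a p q r s → r * (a * s - q) - s * (a * r - p) ≡ p * s - q * r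
    lemma = solve 5 (λ a p q r s → r :* (a :* s :- q) :- s :* (a :* r :- p) := p :* s :- q :* r) refl

  Mk-acc-∷ʳ : ∀ {k} acc (w : Vec (Zmod m) k) a → Mk-acc m acc (w ∷ʳ a) ≡ elem m a · Mk-acc m acc w
  Mk-acc-∷ʳ acc []      a = refl
  Mk-acc-∷ʳ acc (b ∷ w) a = Mk-acc-∷ʳ (elem m b · acc) w a

  Mk-∷ʳ≡⇔ : ∀ {k} (w : Vec (Zmod m) k) a B → Mk m (w ∷ʳ a) ≡ B ⇔ Mk m w ≡ elem⁻¹· a B
  Mk-∷ʳ≡⇔ w a B = subst (λ M → M ≡ B ⇔ Mk m w ≡ elem⁻¹· a B)
    (sym (Mk-acc-∷ʳ (I₂ m) w a)) (elem-·≡⇔ a (Mk m w) B)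

  module _ {p q r s : Zmod m} where

    private
      B = ((p , q) , (r , s))

    I₂≡elem⁻¹·³⇒ : ∀ {a₁ a₂ a₃} → I₂ m ≡ elem⁻¹· a₁ (elem⁻¹· a₂ (elem⁻¹· a₃ B)) →
                    a₁ ≡ a₃ * r - p × a₂ ≡ - s × a₃ * s ≡ q - 1ₘ m
    I₂≡elem⁻¹·³⇒ {a₁} {a₂} {a₃} eq = a₁≡W , a₂≡-s , a₃s≡q-1
      where
      open ≡-Reasoning
      W = a₃ * r - p
      U = a₃ * s - q
      e₁ : 1ₘ m ≡ a₂ * W - r
      e₁ = cong (proj₁ ∘ proj₁) eq
      e₂ : 0ₘ m ≡ a₂ * U - s
      e₂ = cong (proj₂ ∘ proj₁) eq
      e₃ : 0ₘ m ≡ a₁ * (a₂ * W - r) - W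
      e₃ = cong (proj₁ ∘ proj₂) eq
      e₄ : 1ₘ m ≡ a₁ * (a₂ * U - s) - U
      e₄ = cong (proj₂ ∘ proj₂) eq
      U≡-1 : U ≡ - 1ₘ m
      U≡-1 = begin
        U                              ≡⟨ solve 2 (λ a u → u := :- (a :* con 0ℤ :- u)) refl a₁ U ⟩
        - (a₁ * 0ₘ m - U)              ≡⟨ cong (λ z → - (a₁ * z - U)) e₂ ⟩
        - (a₁ * (a₂ * U - s) - U)      ≡⟨ cong -_ e₄ ⟨
        - 1ₘ m                         ∎
      a₁≡W : a₁ ≡ W
      a₁≡W = begin
        a₁                             ≡⟨ solve 2 (λ a w → a := a :* con 1ℤ :- w :+ w) refl a₁ W ⟩
        a₁ * 1ₘ m - W + W              ≡⟨ cong (λ z → a₁ * z - W + W) e₁ ⟩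
        a₁ * (a₂ * W - r) - W + W      ≡⟨ cong (_+ W) e₃ ⟨
        0ₘ m + W                       ≡⟨ +-identityˡ W ⟩
        W                              ∎
      a₂≡-s : a₂ ≡ - s
      a₂≡-s = begin
        a₂                             ≡⟨ solve 2 (λ a s → a := :- (a :* :- con 1ℤ :- s) :- s) refl a₂ s ⟩
        - (a₂ * - 1ₘ m - s) - s        ≡⟨ cong (λ z → - (a₂ * z - s) - s) U≡-1 ⟨
        - (a₂ * U - s) - s             ≡⟨ cong (λ z → - z - s) e₂ ⟨
        - 0ₘ m - s                     ≡⟨ solve 1 (λ s → :- con 0ℤ :- s := :- s) refl s ⟩
        - s                            ∎
      a₃s≡q-1 : a₃ * s ≡ q - 1ₘ m
      a₃s≡q-1 = begin
        a₃ * s                         ≡⟨ solve 3 (λ a s q → a :* s := (a :* s :- q) :+ q) refl a₃ s q ⟩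
        U + q                          ≡⟨ cong (_+ q) U≡-1 ⟩
        - 1ₘ m + q                     ≡⟨ +-comm (- 1ₘ m) q ⟩
        q - 1ₘ m                       ∎

    I₂≡elem⁻¹·³⇐ : ∀ {a₁ a₂ a₃} → p * s - q * r ≡ 1ₘ m →
                    a₁ ≡ a₃ * r - p × a₂ ≡ - s × a₃ * s ≡ q - 1ₘ m →
                    I₂ m ≡ elem⁻¹· a₁ (elem⁻¹· a₂ (elem⁻¹· a₃ B))
    I₂≡elem⁻¹·³⇐ {a₃ = a₃} det≡1 (refl , refl , a₃s≡q-1) =
      cong₂ _,_ (cong₂ _,_ (sym e₁) (sym e₂)) (cong₂ _,_ (sym e₃) (sym e₄))
      where
      open ≡-Reasoning
      W = a₃ * r - p
      U = a₃ * s - q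
      U≡-1 : U ≡ - 1ₘ m
      U≡-1 = begin
        a₃ * s - q                     ≡⟨ cong (_- q) a₃s≡q-1 ⟩
        q - 1ₘ m - q                   ≡⟨ solve 1 (λ q → q :- con 1ℤ :- q := :- con 1ℤ) refl q ⟩
        - 1ₘ m                         ∎
      e₁ : - s * W - r ≡ 1ₘ m
      e₁ = begin
        - s * (a₃ * r - p) - r
          ≡⟨ solve 4 (λ a p r s → :- s :* (a :* r :- p) :- r := p :* s :- (a :* s) :* r :- r) refl a₃ p r s ⟩
        p * s - (a₃ * s) * r - r
          ≡⟨ cong (λ z → p * s - z * r - r) a₃s≡q-1 ⟩
        p * s - (q - 1ₘ m) * r - r
          ≡⟨ solve 4 (λ p q r s → p :* s :- (q :- con 1ℤ) :* r :- r := p :* s :- q :* r) refl p q r s ⟩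
        p * s - q * r
          ≡⟨ det≡1 ⟩
        1ₘ m                           ∎
      e₂ : - s * U - s ≡ 0ₘ m
      e₂ = trans (cong (λ z → - s * z - s) U≡-1) (solve 1 (λ s → :- s :* :- con 1ℤ :- s := con 0ℤ) refl s)
      e₃ : W * (- s * W - r) - W ≡ 0ₘ m
      e₃ = trans (cong (λ z → W * z - W) e₁) (solve 1 (λ w → w :* con 1ℤ :- w := con 0ℤ) refl W)
      e₄ : W * (- s * U - s) - U ≡ 1ₘ m
      e₄ = trans (cong₂ (λ z u → W * z - u) e₂ U≡-1) (solve 1 (λ w → w :* con 0ℤ :- :- con 1ℤ := con 1ℤ) refl W)

    Mk₃≡⇔ : ∀ {a₁ a₂ a₃} → p * s - q * r ≡ 1ₘ m →
            Mk m (a₁ ∷ a₂ ∷ a₃ ∷ []) ≡ B ⇔ (a₁ ≡ a₃ * r - p × a₂ ≡ - s × a₃ * s ≡ q - 1ₘ m)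
    Mk₃≡⇔ {a₁} {a₂} {a₃} det≡1 =
      mk⇔ (I₂≡elem⁻¹·³⇒ {a₁} {a₂} {a₃}) (I₂≡elem⁻¹·³⇐ {a₁} {a₂} {a₃} det≡1)
        ⇔-∘ (elem-·≡⇔ a₁ (I₂ m) _
        ⇔-∘ (elem-·≡⇔ a₂ _ _
        ⇔-∘ elem-·≡⇔ a₃ _ B))


𝟙 : ∀ {p} {P : Set p} → Dec P → ℕ
𝟙 (yes _) = 1
𝟙 (no _)  = 0

𝟙-cong : ∀ {p q} {P : Set p} {Q : Set q} → P ⇔ Q → (P? : Dec P) (Q? : Dec Q) → 𝟙 P? ≡ 𝟙 Q?
𝟙-cong P⇔Q (yes _)  (yes _)  = refl
𝟙-cong P⇔Q (yes p)  (no ¬q)  = ⊥-elim (¬q (Equivalence.to P⇔Q p))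
𝟙-cong P⇔Q (no ¬p)  (yes q)  = ⊥-elim (¬p (Equivalence.from P⇔Q q))
𝟙-cong P⇔Q (no _)   (no _)   = refl

𝟙-yes : ∀ {p} {P : Set p} → P → (P? : Dec P) → 𝟙 P? ≡ 1
𝟙-yes p (yes _) = refl
𝟙-yes p (no ¬p) = ⊥-elim (¬p p)

𝟙-no : ∀ {p} {P : Set p} → ¬ P → (P? : Dec P) → 𝟙 P? ≡ 0
𝟙-no ¬p (yes p) = ⊥-elim (¬p p)
𝟙-no ¬p (no _)  = refl

∑-𝟙-≟ : ∀ {n} (b : Fin n) → ∑[ a < n ] 𝟙 (a Fin.≟ b) ≡ 1
∑-𝟙-≟ {suc n} Fin.zero    = cong suc (trans
  (sum-cong-≗ {n} (λ a → 𝟙-no (λ ()) (Fin.suc a Fin.≟ Fin.zero)))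
  (sum-replicate-zero n))
∑-𝟙-≟ {suc n} (Fin.suc b) = trans
  (sum-cong-≗ (λ a → 𝟙-cong (mk⇔ Fin.suc-injective (cong Fin.suc)) (Fin.suc a Fin.≟ Fin.suc b) (a Fin.≟ b)))
  (∑-𝟙-≟ b)

module _ {n : ℕ} where

  ∑ᵥ : ∀ k → (Vec (Fin n) k → ℕ) → ℕ
  ∑ᵥ zero    f = f []
  ∑ᵥ (suc k) f = ∑[ a < n ] ∑ᵥ k (f ∘ (a ∷_))

  ∑ᵥ-cong : ∀ k {f g : Vec (Fin n) k → ℕ} → (∀ v → f v ≡ g v) → ∑ᵥ k f ≡ ∑ᵥ k g
  ∑ᵥ-cong zero    f≗g = f≗g []
  ∑ᵥ-cong (suc k) f≗g = sum-cong-≗ (λ a → ∑ᵥ-cong k (f≗g ∘ (a ∷_)))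

  ∑ᵥ-∷ʳ : ∀ k (f : Vec (Fin n) (suc k) → ℕ) → ∑ᵥ (suc k) f ≡ ∑[ a < n ] ∑ᵥ k (λ w → f (w ∷ʳ a))
  ∑ᵥ-∷ʳ zero    f = refl
  ∑ᵥ-∷ʳ (suc k) f = trans
    (sum-cong-≗ (λ b → ∑ᵥ-∷ʳ k (f ∘ (b ∷_))))
    (∑-comm (λ b a → ∑ᵥ k (λ w → f (b ∷ (w ∷ʳ a)))))

  ∑ᵥ-𝟙-∅ : ∀ k {p} {P : Pred (Vec (Fin n) k) p} (P? : Decidable P) →
           (∀ v → ¬ P v) → ∑ᵥ k (𝟙 ∘ P?) ≡ 0
  ∑ᵥ-𝟙-∅ zero    P? ¬P = 𝟙-no (¬P []) (P? [])
  ∑ᵥ-𝟙-∅ (suc k) P? ¬P =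
    trans (sum-cong-≗ (λ a → ∑ᵥ-𝟙-∅ k (P? ∘ (a ∷_)) (¬P ∘ (a ∷_)))) (sum-replicate-zero n)

  ∑ᵥ-𝟙-singleton : ∀ k {p} {P : Pred (Vec (Fin n) k) p} (P? : Decidable P) v₀ →
                   (∀ v → P v ⇔ v ≡ v₀) → ∑ᵥ k (𝟙 ∘ P?) ≡ 1
  ∑ᵥ-𝟙-singleton zero    P? []       P⇔≡ = 𝟙-yes (Equivalence.from (P⇔≡ []) refl) (P? [])
  ∑ᵥ-𝟙-singleton (suc k) P? (b ∷ w₀) P⇔≡ = trans (sum-cong-≗ fibre) (∑-𝟙-≟ b)
    where
    open Equivalence
    fibre : ∀ a → ∑ᵥ k (𝟙 ∘ P? ∘ (a ∷_)) ≡ 𝟙 (a Fin.≟ b)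
    fibre a with a Fin.≟ b
    ... | yes refl = ∑ᵥ-𝟙-singleton k (P? ∘ (b ∷_)) w₀
                       (λ w → mk⇔ (∷-injectiveʳ ∘ to (P⇔≡ (b ∷ w))) (from (P⇔≡ (b ∷ w)) ∘ cong (b ∷_)))
    ... | no a≢b   = ∑ᵥ-𝟙-∅ k (P? ∘ (a ∷_)) (λ w → a≢b ∘ ∷-injectiveˡ ∘ to (P⇔≡ (a ∷ w)))

module _ {a b p} {A : Set a} {B : Set b} {P : Pred A p} (P? : Decidable P) where

  length-filter-++ : ∀ xs ys → length (filter P? (xs ++ ys)) ≡ length (filter P? xs) ℕ.+ length (filter P? ys)
  length-filter-++ xs ys = trans (cong length (List.filter-++ P? xs ys)) (List.length-++ (filter P? xs))

  length-filter-map : ∀ (f : B → A) xs → length (filter P? (List.map f xs)) ≡ length (filter (P? ∘ f) xs)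
  length-filter-map f []       = refl
  length-filter-map f (x ∷ xs) with does (P? (f x))
  ... | true  = cong suc (length-filter-map f xs)
  ... | false = length-filter-map f xs

  length-filter-concatMap : ∀ {n} (g : B → List A) (f : Fin n → B) →
    length (filter P? (concatMap g (tabulate f))) ≡ ∑[ i < n ] length (filter P? (g (f i)))
  length-filter-concatMap {zero}  g f = refl
  length-filter-concatMap {suc n} g f = trans
    (length-filter-++ (g (f Fin.zero)) (concatMap g (tabulate (f ∘ Fin.suc))))
    (cong (length (filter P? (g (f Fin.zero))) ℕ.+_) (length-filter-concatMap g (f ∘ Fin.suc)))

length-filter-allVecs : ∀ m k {p} {P : Pred (Vec (Zmod m) k) p} (P? : Decidable P) →
                        length (filter P? (allVecs m k)) ≡ ∑ᵥ k (𝟙 ∘ P?)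
length-filter-allVecs m zero    P? with P? []
... | yes _ = refl
... | no _  = refl
length-filter-allVecs m (suc k) P? = trans
  (length-filter-concatMap P? (λ a → List.map (a ∷_) (allVecs m k)) (λ a → a))
  (sum-cong-≗ (λ a → trans (length-filter-map P? (a ∷_) (allVecs m k))
                           (length-filter-allVecs m k (P? ∘ (a ∷_)))))

∑-periodic₂ : ∀ c (g : ℕ → ℕ) → (∀ i → g (2 ℕ.+ i) ≡ g i) → ∑[ i < c ℕ.* 2 ] g (toℕ i) ≡ c ℕ.* (g 0 ℕ.+ g 1)
∑-periodic₂ zero    g g-periodic = refl
∑-periodic₂ (suc c) g g-periodic = begin
  g 0 ℕ.+ (g 1 ℕ.+ ∑[ i < c ℕ.* 2 ] g (2 ℕ.+ toℕ i))
    ≡⟨ cong (λ z → g 0 ℕ.+ (g 1 ℕ.+ z)) (sum-cong-≗ {c ℕ.* 2} (g-periodic ∘ toℕ)) ⟩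
  g 0 ℕ.+ (g 1 ℕ.+ ∑[ i < c ℕ.* 2 ] g (toℕ i))
    ≡⟨ cong (λ z → g 0 ℕ.+ (g 1 ℕ.+ z)) (∑-periodic₂ c g g-periodic) ⟩
  g 0 ℕ.+ (g 1 ℕ.+ c ℕ.* (g 0 ℕ.+ g 1))
    ≡⟨ ℕ.+-assoc (g 0) (g 1) _ ⟨
  suc c ℕ.* (g 0 ℕ.+ g 1) ∎
  where open ≡-Reasoning

module Parity (m : ℕ) where

  open ZmodRing (suc m)
  module 𝔽₂ = ZmodRing 1

  pattern even = Fin.zero
  pattern odd  = Fin.suc Fin.zero

  parity : Zmod (suc m) → Zmod 1
  parity a = 𝔽₂.[ toℕ a ]

  parity-[] : ∀ x → parity [ x ] ≡ 𝔽₂.[ x ]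
  parity-[] x = Fin.fromℕ<-cong _ _
    (trans (cong (ℕ._% 2) (toℕ-[] x)) (m∣n⇒o%n%m≡o%m 2 (2 ℕ.^ suc m) x (m∣m*n (2 ℕ.^ m)))) _ _

  parity-+ : ∀ a b → parity (a + b) ≡ parity a 𝔽₂.+ parity b
  parity-+ a b = trans (parity-[] (toℕ a ℕ.+ toℕ b)) (𝔽₂.[]-+ (toℕ a) (toℕ b))

  parity-* : ∀ a b → parity (a * b) ≡ parity a 𝔽₂.* parity b
  parity-* a b = trans (parity-[] (toℕ a ℕ.* toℕ b)) (𝔽₂.[]-* (toℕ a) (toℕ b))

  parity-neg : ∀ a → parity (- a) ≡ 𝔽₂.- parity a
  parity-neg a = +-inverseˡ-unique (parity (- a)) (parity a) (begin
    parity (- a) 𝔽₂.+ parity a      ≡⟨ parity-+ (- a) a ⟨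
    parity (- a + a)                ≡⟨ cong parity (-‿inverseˡ a) ⟩
    parity (0ₘ (suc m))             ≡⟨ parity-[] 0 ⟩
    even                            ∎)
    where
    open ≡-Reasoning
    open RingProperties (CommutativeRing.ring 𝔽₂.commutativeRing) using (+-inverseˡ-unique)

  parity-- : ∀ a b → parity (a - b) ≡ parity a 𝔽₂.- parity b
  parity-- a b = trans (parity-+ a (- b)) (cong (𝔽₂._+_ (parity a)) (parity-neg b))

  isUnit⇒odd : ∀ {a} → IsUnit (suc m) a → parity a ≡ odd
  isUnit⇒odd {a} (b , ab≡1) = 𝔽₂-isUnit⇒odd (parity a) (parity b)
    (trans (sym (parity-* a b)) (trans (cong parity ab≡1) (parity-[] 1)))
    where
    𝔽₂-isUnit⇒odd : ∀ x y → x 𝔽₂.* y ≡ odd → x ≡ odd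
    𝔽₂-isUnit⇒odd even y ()
    𝔽₂-isUnit⇒odd odd  y _ = refl

  odd⇒isUnit : ∀ {a} → parity a ≡ odd → IsUnit (suc m) a
  odd⇒isUnit {a} parity-a≡odd = subst (IsUnit (suc m)) (sym a≡1-x) (nilpotent⇒1-x-isUnit x (suc m) x^[1+m]≡0)
    where
    open ≡-Reasoning
    k = toℕ a ℕ./ 2
    x = [ 2 ] * - [ k ]
    toℕ-a≡1+2k : toℕ a ≡ 1 ℕ.+ k ℕ.* 2
    toℕ-a≡1+2k = trans (m≡m%n+[m/n]*n (toℕ a) 2)
      (cong (ℕ._+ k ℕ.* 2) (trans (sym (𝔽₂.toℕ-[] (toℕ a))) (cong toℕ parity-a≡odd)))
    a≡1-x : a ≡ 1ₘ (suc m) - x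
    a≡1-x = begin
      a                       ≡⟨ []-toℕ a ⟨
      [ toℕ a ]               ≡⟨ cong [_] toℕ-a≡1+2k ⟩
      [ 1 ℕ.+ k ℕ.* 2 ]       ≡⟨ trans ([]-+ 1 (k ℕ.* 2)) (cong (_+_ [ 1 ]) ([]-* k 2)) ⟩
      [ 1 ] + [ k ] * [ 2 ]   ≡⟨ solve 2 (λ y t → con 1ℤ :+ y :* t := con 1ℤ :- t :* :- y) refl [ k ] [ 2 ] ⟩
      1ₘ (suc m) - x          ∎
    x^[1+m]≡0 : x ^ suc m ≡ 0ₘ (suc m)
    x^[1+m]≡0 = begin
      ([ 2 ] * - [ k ]) ^ suc m         ≡⟨ ^-distrib-* [ 2 ] (- [ k ]) (suc m) ⟩
      [ 2 ] ^ suc m * - [ k ] ^ suc m   ≡⟨ cong (_* (- [ k ] ^ suc m)) (trans ([]-^ 2 (suc m)) [2^m]≡0) ⟩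
      0ₘ (suc m) * - [ k ] ^ suc m      ≡⟨ CommutativeRing.zeroˡ commutativeRing _ ⟩
      0ₘ (suc m)                        ∎

module CardΔ (m : ℕ) where

  open ZmodRing m
  open Matrix m

  InΔ-∷ʳ⇔ : ∀ {k} (w : Vec (Zmod m) (2 ℕ.+ k)) a B → InΔ m B (w ∷ʳ a) ⇔ InΔ m (elem⁻¹· a B) w
  InΔ-∷ʳ⇔ w@(_ ∷ _ ∷ _) a B = mk⇔ (map₁ (Equivalence.to (Mk-∷ʳ≡⇔ w a B))) (map₁ (Equivalence.from (Mk-∷ʳ≡⇔ w a B)))

  cardΔ-∷ʳ : ∀ k B → cardΔ m (3 ℕ.+ k) B ≡ ∑[ a < 2 ℕ.^ m ] cardΔ m (2 ℕ.+ k) (elem⁻¹· a B)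
  cardΔ-∷ʳ k B = begin
    cardΔ m (3 ℕ.+ k) B
      ≡⟨ length-filter-allVecs m (3 ℕ.+ k) (inΔ? m B) ⟩
    ∑ᵥ (3 ℕ.+ k) (𝟙 ∘ inΔ? m B)
      ≡⟨ ∑ᵥ-∷ʳ (2 ℕ.+ k) (𝟙 ∘ inΔ? m B) ⟩
    ∑[ a < 2 ℕ.^ m ] ∑ᵥ (2 ℕ.+ k) (λ w → 𝟙 (inΔ? m B (w ∷ʳ a)))
      ≡⟨ sum-cong-≗ {2 ℕ.^ m} (λ a → ∑ᵥ-cong (2 ℕ.+ k) (λ w →
           𝟙-cong (InΔ-∷ʳ⇔ w a B) (inΔ? m B (w ∷ʳ a)) (inΔ? m (elem⁻¹· a B) w))) ⟩
    ∑[ a < 2 ℕ.^ m ] ∑ᵥ (2 ℕ.+ k) (𝟙 ∘ inΔ? m (elem⁻¹· a B))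
      ≡⟨ sum-cong-≗ {2 ℕ.^ m} (λ a → length-filter-allVecs m (2 ℕ.+ k) (inΔ? m (elem⁻¹· a B))) ⟨
    ∑[ a < 2 ℕ.^ m ] cardΔ m (2 ℕ.+ k) (elem⁻¹· a B) ∎
    where open ≡-Reasoning

  module _ {p q r s : Zmod m} (det≡1 : p * s - q * r ≡ 1ₘ m) where

    private
      B = ((p , q) , (r , s))

    solution : Zmod m → Vec (Zmod m) 3
    solution t = t * (q - 1ₘ m) * r - p ∷ - s ∷ t * (q - 1ₘ m) ∷ []

    solution-InΔ : ∀ {t} → s * t ≡ 1ₘ m → InΔ m B (solution t)
    solution-InΔ {t} st≡1 =
      Equivalence.from (Mk₃≡⇔ {a₁ = t * (q - 1ₘ m) * r - p} {a₂ = - s} {a₃ = t * (q - 1ₘ m)} det≡1)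
        (refl , refl , a₃s≡q-1)
      , (- t , -s*-t≡1)
      where
      open ≡-Reasoning
      a₃s≡q-1 : t * (q - 1ₘ m) * s ≡ q - 1ₘ m
      a₃s≡q-1 = begin
        t * (q - 1ₘ m) * s     ≡⟨ solve 3 (λ t x s → t :* x :* s := x :* (s :* t)) refl t (q - 1ₘ m) s ⟩
        (q - 1ₘ m) * (s * t)   ≡⟨ cong (_*_ (q - 1ₘ m)) st≡1 ⟩
        (q - 1ₘ m) * 1ₘ m      ≡⟨ solve 1 (λ x → x :* con 1ℤ := x) refl (q - 1ₘ m) ⟩
        q - 1ₘ m               ∎
      -s*-t≡1 : - s * - t ≡ 1ₘ m
      -s*-t≡1 = trans (solve 2 (λ s t → :- s :* :- t := s :* t) refl s t) st≡1

    Mk₃≡B⇒≡solution : ∀ {t a₁ a₂ a₃} → s * t ≡ 1ₘ m →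
                      Mk m (a₁ ∷ a₂ ∷ a₃ ∷ []) ≡ B → a₁ ∷ a₂ ∷ a₃ ∷ [] ≡ solution t
    Mk₃≡B⇒≡solution {t} {a₁} {a₂} {a₃} st≡1 Mk≡B =
      cong₂ _∷_ (trans a₁≡ (cong (λ z → z * r - p) a₃≡)) (cong₂ _∷_ a₂≡ (cong (_∷ []) a₃≡))
      where
      open ≡-Reasoning
      equations = Equivalence.to (Mk₃≡⇔ {a₁ = a₁} {a₂ = a₂} {a₃ = a₃} det≡1) Mk≡B
      a₁≡ = proj₁ equations
      a₂≡ = proj₁ (proj₂ equations)
      a₃s≡q-1 = proj₂ (proj₂ equations)
      a₃≡ : a₃ ≡ t * (q - 1ₘ m)
      a₃≡ = begin
        a₃
          ≡⟨ solve 3 (λ a s t → a := a :* s :* t :+ a :* (con 1ℤ :- s :* t)) refl a₃ s t ⟩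
        a₃ * s * t + a₃ * (1ₘ m - s * t)
          ≡⟨ cong₂ (λ x y → x * t + a₃ * (1ₘ m - y)) a₃s≡q-1 st≡1 ⟩
        (q - 1ₘ m) * t + a₃ * (1ₘ m - 1ₘ m)
          ≡⟨ solve 3 (λ x t a → x :* t :+ a :* (con 1ℤ :- con 1ℤ) := t :* x) refl (q - 1ₘ m) t a₃ ⟩
        t * (q - 1ₘ m) ∎

    InΔ₃⇔≡solution : ∀ t → s * t ≡ 1ₘ m → ∀ v → InΔ m B v ⇔ v ≡ solution t
    InΔ₃⇔≡solution t st≡1 (a₁ ∷ a₂ ∷ a₃ ∷ []) =
      mk⇔ (Mk₃≡B⇒≡solution st≡1 ∘ proj₁) (λ { refl → solution-InΔ st≡1 })

    InΔ₃⇒isUnit : ∀ (v : Vec (Zmod m) 3) → InΔ m B v → IsUnit m s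
    InΔ₃⇒isUnit (a₁ ∷ a₂ ∷ a₃ ∷ []) (Mk≡B , (b , a₂b≡1)) = - b , (begin
      s * - b     ≡⟨ solve 2 (λ s b → s :* :- b := :- s :* b) refl s b ⟩
      - s * b     ≡⟨ cong (_* b) a₂≡-s ⟨
      a₂ * b      ≡⟨ a₂b≡1 ⟩
      1ₘ m        ∎)
      where
      open ≡-Reasoning
      a₂≡-s = proj₁ (proj₂ (Equivalence.to (Mk₃≡⇔ {a₁ = a₁} {a₂ = a₂} {a₃ = a₃} det≡1) Mk≡B))

    cardΔ₃ : cardΔ m 3 B ≡ 𝟙 (isUnit? m s)
    cardΔ₃ = trans (length-filter-allVecs m 3 (inΔ? m B)) (cases (isUnit? m s))
      where
      cases : (u : Dec (IsUnit m s)) → ∑ᵥ 3 (𝟙 ∘ inΔ? m B) ≡ 𝟙 u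
      cases (yes (t , st≡1)) = ∑ᵥ-𝟙-singleton 3 (inΔ? m B) (solution t) (InΔ₃⇔≡solution t st≡1)
      cases (no ¬unit)       = ∑ᵥ-𝟙-∅ 3 (inΔ? m B) (λ v → ¬unit ∘ InΔ₃⇒isUnit v)

module ParityCount (m : ℕ) where

  open ZmodRing (suc m)
  open Matrix (suc m)
  open CardΔ (suc m)
  open Parity m

  c : ℕ
  c = 2 ℕ.^ m

  ∑-parity : ∀ (h : Zmod 1 → ℕ) → ∑[ a < 2 ℕ.^ suc m ] h (parity a) ≡ c ℕ.* (h even ℕ.+ h odd)
  -- Periodicity holds by refl: (2 + i) % 2 reduces to i % 2.
  ∑-parity h = subst (λ n → ∑[ i < n ] h 𝔽₂.[ toℕ i ] ≡ c ℕ.* (h even ℕ.+ h odd))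
    (ℕ.*-comm c 2) (∑-periodic₂ c (h ∘ 𝔽₂.[_]) (λ i → refl))

  count : ℕ → Zmod 1 → ℕ
  count zero    even = 0
  count zero    odd  = 1
  count (suc i) even = c ℕ.* (count i odd ℕ.+ count i odd)
  count (suc i) odd  = c ℕ.* (count i even ℕ.+ count i odd)

  count-step : ∀ i πp πs πq πr → πp 𝔽₂.* πs 𝔽₂.- πq 𝔽₂.* πr ≡ odd →
               c ℕ.* (count i (even 𝔽₂.* πs 𝔽₂.- πq) ℕ.+ count i (odd 𝔽₂.* πs 𝔽₂.- πq)) ≡ count (suc i) πs
  -- s and q cannot both be even, as p s - q r = 1.
  count-step i πp even even πr det≡1 = ⊥-elim (Fin.0≢1+n (trans (sym (𝔽₂.solve 2
    (λ x y → x 𝔽₂.:* 𝔽₂.con 0ℤ 𝔽₂.:- 𝔽₂.con 0ℤ 𝔽₂.:* y 𝔽₂.:= 𝔽₂.con 0ℤ) refl πp πr)) det≡1))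
  count-step i πp even odd  πr _     = refl
  count-step i πp odd  even πr _     = refl
  count-step i πp odd  odd  πr _     = cong (c ℕ.*_) (ℕ.+-comm (count i odd) (count i even))

  parity-det : ∀ p q r s → parity (p * s - q * r) ≡ parity p 𝔽₂.* parity s 𝔽₂.- parity q 𝔽₂.* parity r
  parity-det p q r s = trans (parity-- (p * s) (q * r)) (cong₂ 𝔽₂._-_ (parity-* p s) (parity-* q r))

  parity-affine : ∀ a s q → parity (a * s - q) ≡ parity a 𝔽₂.* parity s 𝔽₂.- parity q
  parity-affine a s q = trans (parity-- (a * s) q) (cong (𝔽₂._- parity q) (parity-* a s))

  𝟙-isUnit≡count₀ : ∀ s → 𝟙 (isUnit? (suc m) s) ≡ count 0 (parity s)
  𝟙-isUnit≡count₀ s with parity s in parity-s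
  ... | even = 𝟙-no (λ unit → Fin.0≢1+n (trans (sym parity-s) (isUnit⇒odd {s} unit))) (isUnit? (suc m) s)
  ... | odd  = 𝟙-yes (odd⇒isUnit {s} parity-s) (isUnit? (suc m) s)

  cardΔ≡count : ∀ i {p q r s} → p * s - q * r ≡ 1ₘ (suc m) →
                cardΔ (suc m) (3 ℕ.+ i) ((p , q) , (r , s)) ≡ count i (parity s)
  cardΔ≡count zero    {s = s} det≡1 = trans (cardΔ₃ det≡1) (𝟙-isUnit≡count₀ s)
  cardΔ≡count (suc i) {p} {q} {r} {s} det≡1 = begin
    cardΔ (suc m) (4 ℕ.+ i) B
      ≡⟨ cardΔ-∷ʳ (suc i) B ⟩
    ∑[ a < 2 ℕ.^ suc m ] cardΔ (suc m) (3 ℕ.+ i) (elem⁻¹· a B)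
      ≡⟨ sum-cong-≗ {2 ℕ.^ suc m} (λ a → cardΔ≡count i (trans (det-elem⁻¹· a B) det≡1)) ⟩
    ∑[ a < 2 ℕ.^ suc m ] count i (parity (a * s - q))
      ≡⟨ sum-cong-≗ {2 ℕ.^ suc m} (λ a → cong (count i) (parity-affine a s q)) ⟩
    ∑[ a < 2 ℕ.^ suc m ] count i (parity a 𝔽₂.* parity s 𝔽₂.- parity q)
      ≡⟨ ∑-parity (λ x → count i (x 𝔽₂.* parity s 𝔽₂.- parity q)) ⟩
    c ℕ.* (count i (even 𝔽₂.* parity s 𝔽₂.- parity q) ℕ.+ count i (odd 𝔽₂.* parity s 𝔽₂.- parity q))
      ≡⟨ count-step i (parity p) (parity s) (parity q) (parity r) parity-det≡1 ⟩
    count (suc i) (parity s) ∎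
    where
    open ≡-Reasoning
    B = ((p , q) , (r , s))
    parity-det≡1 : parity p 𝔽₂.* parity s 𝔽₂.- parity q 𝔽₂.* parity r ≡ odd
    parity-det≡1 = trans (sym (parity-det p q r s)) (trans (cong parity det≡1) (parity-[] 1))

  count-recurrence : ∀ i b → count (2 ℕ.+ i) b ≡ c ℕ.* count (1 ℕ.+ i) b ℕ.+ 2 ℕ.* c ℕ.* c ℕ.* count i b
  count-recurrence i even = lemma c (count i odd) (count i even)
    where
    lemma : ∀ c x y → c ℕ.* (c ℕ.* (y ℕ.+ x) ℕ.+ c ℕ.* (y ℕ.+ x)) ≡ c ℕ.* (c ℕ.* (x ℕ.+ x)) ℕ.+ 2 ℕ.* c ℕ.* c ℕ.* y
    lemma = ℕ-solve-∀
  count-recurrence i odd  = lemma c (count i odd) (count i even)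
    where
    lemma : ∀ c x y → c ℕ.* (c ℕ.* (x ℕ.+ x) ℕ.+ c ℕ.* (y ℕ.+ x)) ≡ c ℕ.* (c ℕ.* (y ℕ.+ x)) ℕ.+ 2 ℕ.* c ℕ.* c ℕ.* x
    lemma = ℕ-solve-∀

  cardΔ-recurrence : ∀ {p q r s} → p * s - q * r ≡ 1ₘ (suc m) → ∀ i →
    cardΔ (suc m) (5 ℕ.+ i) ((p , q) , (r , s))
      ≡ c ℕ.* cardΔ (suc m) (4 ℕ.+ i) ((p , q) , (r , s))
        ℕ.+ 2 ℕ.* c ℕ.* c ℕ.* cardΔ (suc m) (3 ℕ.+ i) ((p , q) , (r , s))
  cardΔ-recurrence {p} {q} {r} {s} det≡1 i = begin
    cardΔ (suc m) (5 ℕ.+ i) B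
      ≡⟨ cardΔ≡count (2 ℕ.+ i) {p} {q} {r} {s} det≡1 ⟩
    count (2 ℕ.+ i) (parity s)
      ≡⟨ count-recurrence i (parity s) ⟩
    c ℕ.* count (1 ℕ.+ i) (parity s) ℕ.+ 2 ℕ.* c ℕ.* c ℕ.* count i (parity s)
      ≡⟨ cong₂ (λ x y → c ℕ.* x ℕ.+ 2 ℕ.* c ℕ.* c ℕ.* y) (cardΔ≡count (1 ℕ.+ i) {p} {q} {r} {s} det≡1)
                                                         (cardΔ≡count i {p} {q} {r} {s} det≡1) ⟨
    c ℕ.* cardΔ (suc m) (4 ℕ.+ i) B ℕ.+ 2 ℕ.* c ℕ.* c ℕ.* cardΔ (suc m) (3 ℕ.+ i) B ∎
    where
    open ≡-Reasoning
    B = ((p , q) , (r , s))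

module Arithmetic where

  open import Data.Integer using (+_; _+_; _-_; _*_; -_; _^_)
  open import Data.Integer.Tactic.RingSolver using (solve-∀)
  open import Data.Rational as ℚ using (_/_; toℚᵘ)
  import Data.Rational.Properties as ℚ
  open import Data.Rational.Unnormalised as ℚᵘ using (mkℚᵘ; *≡*; _≃_)
  import Data.Rational.Unnormalised.Properties as ℚᵘ

  pos-^ : ∀ a n → + (a ℕ.^ n) ≡ (+ a) ^ n
  pos-^ a zero    = refl
  pos-^ a (suc n) = trans (ℤ.pos-* a (a ℕ.^ n)) (cong (+ a *_) (pos-^ a n))

  pos-[cx+2ccy] : ∀ c x y → + (c ℕ.* x ℕ.+ 2 ℕ.* c ℕ.* c ℕ.* y) ≡ + c * + x + + 2 * + c * + c * + y
  pos-[cx+2ccy] c x y = trans (ℤ.pos-+ (c ℕ.* x) _) (cong₂ _+_ (ℤ.pos-* c x)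
    (trans (ℤ.pos-* (2 ℕ.* c ℕ.* c) y) (cong (_* + y) (trans (ℤ.pos-* (2 ℕ.* c) c) (cong (_* + c) (ℤ.pos-* 2 c))))))

  module LinearRecurrence (C : ℤ) (Z : ℕ → ℤ)
                          (Z-rec : ∀ i → Z (2 ℕ.+ i) ≡ C * Z (1 ℕ.+ i) + + 2 * C * C * Z i) where

    ClosedForm : ℕ → Set
    ClosedForm i = + 3 * Z (suc i) ≡ C ^ i * ((+ 2) ^ suc i + sgn i) * Z 1
                                    + C ^ suc i * ((+ 2) ^ suc i - + 2 * sgn i) * Z 0

    private
      closedForm₀ : ClosedForm 0
      closedForm₀ = lemma C (Z 1) (Z 0)
        where
        lemma : ∀ C z₁ z₀ → + 3 * z₁ ≡ + 1 * (+ 2 + + 1) * z₁ + C * + 1 * (+ 2 - + 2 * + 1) * z₀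
        lemma = solve-∀

      closedForm₁ : ClosedForm 1
      closedForm₁ = trans (cong (+ 3 *_) (Z-rec 0)) (lemma C (Z 1) (Z 0))
        where
        lemma : ∀ C z₁ z₀ → + 3 * (C * z₁ + + 2 * C * C * z₀)
                           ≡ C * + 1 * (+ 4 + - + 1) * z₁ + C * (C * + 1) * (+ 4 - + 2 * - + 1) * z₀
        lemma = solve-∀

      closedForm-step : ∀ i → ClosedForm i → ClosedForm (suc i) → ClosedForm (2 ℕ.+ i)
      closedForm-step i hᵢ hᵢ₊₁ = begin
        + 3 * Z (3 ℕ.+ i)                                      ≡⟨ cong (+ 3 *_) (Z-rec (suc i)) ⟩
        + 3 * (C * Z (2 ℕ.+ i) + + 2 * C * C * Z (1 ℕ.+ i))    ≡⟨ distribute C (Z (2 ℕ.+ i)) (Z (1 ℕ.+ i)) ⟩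
        C * (+ 3 * Z (2 ℕ.+ i)) + + 2 * C * C * (+ 3 * Z (1 ℕ.+ i)) ≡⟨ cong₂ (λ x y → C * x + + 2 * C * C * y) hᵢ₊₁ hᵢ ⟩
        C * (C * P * (+ 2 * T - σ) * Z 1 + C * (C * P) * (+ 2 * T - + 2 * - σ) * Z 0)
          + + 2 * C * C * (P * (T + σ) * Z 1 + C * P * (T - + 2 * σ) * Z 0)
                                                               ≡⟨ collect C P T σ (Z 1) (Z 0) ⟩
        C * (C * P) * (+ 2 * (+ 2 * T) + - - σ) * Z 1
          + C * (C * (C * P)) * (+ 2 * (+ 2 * T) - + 2 * - - σ) * Z 0 ∎
        where
        open ≡-Reasoning
        P = C ^ i
        T = (+ 2) ^ suc i
        σ = sgn i
        distribute : ∀ C x y → + 3 * (C * x + + 2 * C * C * y) ≡ C * (+ 3 * x) + + 2 * C * C * (+ 3 * y)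
        distribute = solve-∀
        collect : ∀ C P T σ z₁ z₀ →
          C * (C * P * (+ 2 * T - σ) * z₁ + C * (C * P) * (+ 2 * T - + 2 * - σ) * z₀)
            + + 2 * C * C * (P * (T + σ) * z₁ + C * P * (T - + 2 * σ) * z₀)
          ≡ C * (C * P) * (+ 2 * (+ 2 * T) + - - σ) * z₁
            + C * (C * (C * P)) * (+ 2 * (+ 2 * T) - + 2 * - - σ) * z₀
        collect = solve-∀

      closedForm-pair : ∀ i → ClosedForm i × ClosedForm (suc i)
      closedForm-pair zero    = closedForm₀ , closedForm₁
      closedForm-pair (suc i) = proj₂ (closedForm-pair i) , uncurry (closedForm-step i) (closedForm-pair i)

    closedForm : ∀ i → ClosedForm i
    closedForm i = proj₁ (closedForm-pair i)

  toℚᵘ-/ : ∀ n d → toℚᵘ (n / suc d) ≃ mkℚᵘ n d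
  toℚᵘ-/ n d = ℚ.toℚᵘ-fromℚᵘ (mkℚᵘ n d)

  toℚᵘ-*³ : ∀ p q r → toℚᵘ (p ℚ.* q ℚ.* r) ≃ toℚᵘ p ℚᵘ.* toℚᵘ q ℚᵘ.* toℚᵘ r
  toℚᵘ-*³ p q r = ℚᵘ.≃-trans (ℚ.toℚᵘ-homo-* (p ℚ.* q) r) (ℚᵘ.*-congʳ (ℚ.toℚᵘ-homo-* p q))

  rational-form : ∀ (x y₁ y₀ a₁ w₁ a₂ w₂ : ℤ) → + 3 * x ≡ a₁ * w₁ * y₁ + a₂ * w₂ * y₀ →
                  x / 1 ≡ a₁ / 8 ℚ.* ((+ 8 * w₁) / 3) ℚ.* (y₁ / 1) ℚ.+ a₂ / 8 ℚ.* ((+ 8 * w₂) / 3) ℚ.* (y₀ / 1)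
  rational-form x y₁ y₀ a₁ w₁ a₂ w₂ 3x≡ = ℚ.toℚᵘ-injective (begin
    toℚᵘ (x / 1)
      ≈⟨ toℚᵘ-/ x 0 ⟩
    mkℚᵘ x 0
      ≈⟨ *≡* cross-multiplied ⟩
    mkℚᵘ a₁ 7 ℚᵘ.* mkℚᵘ (+ 8 * w₁) 2 ℚᵘ.* mkℚᵘ y₁ 0 ℚᵘ.+ mkℚᵘ a₂ 7 ℚᵘ.* mkℚᵘ (+ 8 * w₂) 2 ℚᵘ.* mkℚᵘ y₀ 0
      ≈⟨ ℚᵘ.+-cong (term a₁ w₁ y₁) (term a₂ w₂ y₀) ⟨
    toℚᵘ t₁ ℚᵘ.+ toℚᵘ t₂
      ≈⟨ ℚ.toℚᵘ-homo-+ t₁ t₂ ⟨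
    toℚᵘ (t₁ ℚ.+ t₂) ∎)
    where
    open ℚᵘ.≃-Reasoning
    t₁ = a₁ / 8 ℚ.* ((+ 8 * w₁) / 3) ℚ.* (y₁ / 1)
    t₂ = a₂ / 8 ℚ.* ((+ 8 * w₂) / 3) ℚ.* (y₀ / 1)
    term : ∀ a w y → toℚᵘ (a / 8 ℚ.* ((+ 8 * w) / 3) ℚ.* (y / 1)) ≃ mkℚᵘ a 7 ℚᵘ.* mkℚᵘ (+ 8 * w) 2 ℚᵘ.* mkℚᵘ y 0
    term a w y = ℚᵘ.≃-trans (toℚᵘ-*³ (a / 8) ((+ 8 * w) / 3) (y / 1))
      (ℚᵘ.*-cong (ℚᵘ.*-cong (toℚᵘ-/ a 7) (toℚᵘ-/ (+ 8 * w) 2)) (toℚᵘ-/ y 0))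
    cross-multiplied : x * + 576 ≡ (a₁ * (+ 8 * w₁) * y₁ * + 24 + a₂ * (+ 8 * w₂) * y₀ * + 24) * + 1
    cross-multiplied = trans (scale x) (trans (cong (_* + 192) 3x≡) (expand a₁ w₁ y₁ a₂ w₂ y₀))
      where
      scale : ∀ x → x * + 576 ≡ + 3 * x * + 192
      scale = solve-∀
      expand : ∀ a₁ w₁ y₁ a₂ w₂ y₀ → (a₁ * w₁ * y₁ + a₂ * w₂ * y₀) * + 192
                                     ≡ (a₁ * (+ 8 * w₁) * y₁ * + 24 + a₂ * (+ 8 * w₂) * y₀ * + 24) * + 1
      expand = solve-∀

  pow2-[k-3] : ∀ k → pow2 (+ k - + 3) ≡ (+ (2 ℕ.^ k)) / 8
  pow2-[k-3] 0                   = refl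
  pow2-[k-3] 1                   = refl
  pow2-[k-3] 2                   = refl
  pow2-[k-3] (suc (suc (suc j))) =
    ℚ.fromℚᵘ-cong {mkℚᵘ (+ (2 ℕ.^ j)) 0} {mkℚᵘ (+ (2 ℕ.^ (3 ℕ.+ j))) 7} (*≡* (begin
    + (2 ℕ.^ j) * + 8               ≡⟨ ℤ.pos-* (2 ℕ.^ j) 8 ⟨
    + (2 ℕ.^ j ℕ.* 8)               ≡⟨ cong +_ (ℕ.*-comm (2 ℕ.^ j) 8) ⟩
    + (8 ℕ.* 2 ℕ.^ j)               ≡⟨ cong +_ (ℕ.^-distribˡ-+-* 2 3 j) ⟨
    + (2 ℕ.^ (3 ℕ.+ j))             ≡⟨ ℤ.*-identityʳ _ ⟨
    + (2 ℕ.^ (3 ℕ.+ j)) * + 1       ∎))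
    where open ≡-Reasoning

  pow2-[mn-n-4m+1] : ∀ m t → pow2 (+ (suc m ℕ.* (5 ℕ.+ t)) - + (5 ℕ.+ t) - + (4 ℕ.* suc m) + + 1)
                             ≡ ((+ (2 ℕ.^ m)) ^ (1 ℕ.+ t)) / 8
  pow2-[mn-n-4m+1] m t = begin
    pow2 (+ (suc m ℕ.* (5 ℕ.+ t)) - + (5 ℕ.+ t) - + (4 ℕ.* suc m) + + 1)
      ≡⟨ cong₂ (λ x y → pow2 (x - + (5 ℕ.+ t) - y + + 1)) (ℤ.pos-* (suc m) (5 ℕ.+ t)) (ℤ.pos-* 4 (suc m)) ⟩
    pow2 ((+ 1 + + m) * (+ 5 + + t) - (+ 5 + + t) - + 4 * (+ 1 + + m) + + 1)
      ≡⟨ cong pow2 (exponent (+ m) (+ t)) ⟩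
    pow2 (+ m * (+ 1 + + t) - + 3)
      ≡⟨ cong (λ x → pow2 (x - + 3)) (ℤ.pos-* m (1 ℕ.+ t)) ⟨
    pow2 (+ (m ℕ.* (1 ℕ.+ t)) - + 3)
      ≡⟨ pow2-[k-3] (m ℕ.* (1 ℕ.+ t)) ⟩
    + (2 ℕ.^ (m ℕ.* (1 ℕ.+ t))) / 8
      ≡⟨ cong (_/ 8) (trans (cong +_ (sym (ℕ.^-*-assoc 2 m (1 ℕ.+ t)))) (pos-^ (2 ℕ.^ m) (1 ℕ.+ t))) ⟩
    ((+ (2 ℕ.^ m)) ^ (1 ℕ.+ t)) / 8 ∎
    where
    open ≡-Reasoning
    exponent : ∀ m t → (+ 1 + m) * (+ 5 + t) - (+ 5 + t) - + 4 * (+ 1 + m) + + 1 ≡ m * (+ 1 + t) - + 3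
    exponent = solve-∀

  pow2-[mn-n-3m] : ∀ m t → pow2 (+ (suc m ℕ.* (5 ℕ.+ t)) - + (5 ℕ.+ t) - + (3 ℕ.* suc m))
                           ≡ ((+ (2 ℕ.^ m)) ^ (2 ℕ.+ t)) / 8
  pow2-[mn-n-3m] m t = begin
    pow2 (+ (suc m ℕ.* (5 ℕ.+ t)) - + (5 ℕ.+ t) - + (3 ℕ.* suc m))
      ≡⟨ cong₂ (λ x y → pow2 (x - + (5 ℕ.+ t) - y)) (ℤ.pos-* (suc m) (5 ℕ.+ t)) (ℤ.pos-* 3 (suc m)) ⟩
    pow2 ((+ 1 + + m) * (+ 5 + + t) - (+ 5 + + t) - + 3 * (+ 1 + + m))
      ≡⟨ cong pow2 (exponent (+ m) (+ t)) ⟩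
    pow2 (+ m * (+ 2 + + t) - + 3)
      ≡⟨ cong (λ x → pow2 (x - + 3)) (ℤ.pos-* m (2 ℕ.+ t)) ⟨
    pow2 (+ (m ℕ.* (2 ℕ.+ t)) - + 3)
      ≡⟨ pow2-[k-3] (m ℕ.* (2 ℕ.+ t)) ⟩
    + (2 ℕ.^ (m ℕ.* (2 ℕ.+ t))) / 8
      ≡⟨ cong (_/ 8) (trans (cong +_ (sym (ℕ.^-*-assoc 2 m (2 ℕ.+ t)))) (pos-^ (2 ℕ.^ m) (2 ℕ.+ t))) ⟩
    ((+ (2 ℕ.^ m)) ^ (2 ℕ.+ t)) / 8 ∎
    where
    open ≡-Reasoning
    exponent : ∀ m t → (+ 1 + m) * (+ 5 + t) - (+ 5 + t) - + 3 * (+ 1 + m) ≡ m * (+ 2 + t) - + 3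
    exponent = solve-∀

  2^n+8[-1]^n : ∀ t → + (2 ℕ.^ (5 ℕ.+ t)) + sgn (5 ℕ.+ t) * + 8 ≡ + 8 * ((+ 2) ^ (2 ℕ.+ t) + sgn (1 ℕ.+ t))
  2^n+8[-1]^n t = trans (cong (_+ sgn (5 ℕ.+ t) * + 8) (pos-^ 2 (5 ℕ.+ t))) (lemma ((+ 2) ^ (2 ℕ.+ t)) (sgn t))
    where
    lemma : ∀ T σ → + 2 * (+ 2 * (+ 2 * T)) + - - - - - σ * + 8 ≡ + 8 * (T + - σ)
    lemma = solve-∀

  2^n-16[-1]^n : ∀ t → + (2 ℕ.^ (5 ℕ.+ t)) + sgn (6 ℕ.+ t) * + 16 ≡ + 8 * ((+ 2) ^ (2 ℕ.+ t) - + 2 * sgn (1 ℕ.+ t))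
  2^n-16[-1]^n t = trans (cong (_+ sgn (6 ℕ.+ t) * + 16) (pos-^ 2 (5 ℕ.+ t))) (lemma ((+ 2) ^ (2 ℕ.+ t)) (sgn t))
    where
    lemma : ∀ T σ → + 2 * (+ 2 * (+ 2 * T)) + - - - - - - σ * + 16 ≡ + 8 * (T - + 2 * - σ)
    lemma = solve-∀

open Arithmetic

open import Data.Nat using (ℕ; _≤_; _<_; suc) renaming (_*_ to _*ℕ_; _^_ to _^ℕ_)
open import Data.Integer using (+_) renaming (_-_ to _-ℤ_; _+_ to _+ℤ_; _*_ to _*ℤ_)
open import Data.Rational using (ℚ; _/_; _*_; _+_)
open import Data.Nat using (s≤s; z≤n)

proposition2p4 : (m : ℕ) → 2 ≤ m → (B : Mat m) → InSL₂ m B → (n : ℕ) → 4 < n →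
    (+ cardΔ m n B) / 1
      ≡ pow2 (+ (m *ℕ n) -ℤ + n -ℤ + (4 *ℕ m) +ℤ + 1)
          * ((+ (2 ^ℕ n) +ℤ sgn n *ℤ + 8) / 3)
          * ((+ cardΔ m 4 B) / 1)
        + pow2 (+ (m *ℕ n) -ℤ + n -ℤ + (3 *ℕ m))
          * ((+ (2 ^ℕ n) +ℤ sgn (suc n) *ℤ + 16) / 3)
          * ((+ cardΔ m 3 B) / 1)
proposition2p4 (suc m) _ B@((p , q) , (r , s)) det≡1 (suc (suc (suc (suc (suc t))))) (s≤s (s≤s (s≤s (s≤s (s≤s z≤n))))) =
  trans (rational-form (Z (2 ℕ.+ t)) (Z 1) (Z 0) (C ℤ.^ (1 ℕ.+ t)) w₁ (C ℤ.^ (2 ℕ.+ t)) w₂ (closedForm (1 ℕ.+ t)))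
        (sym (cong₂ _+_ (cong₂ (λ a w → a * (w / 3) * (Z 1 / 1)) (pow2-[mn-n-4m+1] m t) (2^n+8[-1]^n t))
                        (cong₂ (λ a w → a * (w / 3) * (Z 0 / 1)) (pow2-[mn-n-3m] m t) (2^n-16[-1]^n t))))
  where
  open ParityCount m using (cardΔ-recurrence)
  C = + (2 ^ℕ m)
  w₁ = (+ 2) ℤ.^ (2 ℕ.+ t) +ℤ sgn (1 ℕ.+ t)
  w₂ = (+ 2) ℤ.^ (2 ℕ.+ t) -ℤ + 2 *ℤ sgn (1 ℕ.+ t)
  Z : ℕ → ℤ
  Z i = + cardΔ (suc m) (3 ℕ.+ i) B
  Z-rec : ∀ i → Z (2 ℕ.+ i) ≡ C *ℤ Z (1 ℕ.+ i) +ℤ + 2 *ℤ C *ℤ C *ℤ Z i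
  Z-rec i = trans (cong +_ (cardΔ-recurrence {p} {q} {r} {s} det≡1 i)) (pos-[cx+2ccy] (2 ^ℕ m) _ _)
  open LinearRecurrence C Z Z-rec using (closedForm)
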